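{- For any $r \ge 2$, $\mathrm{Hi}_r(r) \le r^2$; that is, every $r$-partite $r$-graph which is $(r,m)$-coverable for some positive integer $m$ has cover number at most $r^2$.
   Context: An $r$-graph is $r$-partite if its vertex set splits into $r$ parts with every edge having exactly one vertex in each part; $\tau(H)$ is the minimum size of a vertex set meeting every edge. For positive integers $k,m$, an $r$-partite $r$-graph $H_0$ is $(k,m)$-coverable if there exist $r$-partite $r$-graphs $H_0 \supseteq H_1 \supseteq \dots \supseteq H_m$ such that: (P1) for any $k-1$ edges of $H_0$ there is an edge $e \in E(H_m)$ intersecting each of them; (P2) for any edges $e_1,\dots,e_{k-1} \in E(H_0)$ and any edge $e_k \in E(H_i)$ with $0 \le i \le m-1$, there is an edge $f \in E(H_{i+1})$ intersecting all of $e_1,\dots,e_k$; (P3) all edges of $H_m$ pairwise intersect. $\mathrm{hi}_r(k,m)$ is the largest cover number of a $(k,m)$-coverable $r$-partite $r$-graph, and $\mathrm{Hi}_r(k) = \max_{m \in \mathbb{N}} \mathrm{hi}_r(k,m)$. -}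

module Defs where

open import Data.Nat using (ℕ; zero; suc; _≤_; _<_; _∸_)
open import Data.Fin using (Fin)
open import Data.Vec using (Vec; lookup)
open import Data.List using (List; length)
open import Data.List.Membership.Propositional using (_∈_)
open import Data.List.Relation.Binary.Subset.Propositional using (_⊆_)
open import Data.Product using (Σ; ∃; _×_)
open import Relation.Binary.PropositionalEquality using (_≡_)

-- An r-partite r-graph with vertex classes V_0,…,V_{r-1}, where the
-- vertices of class i are the pairs (i , v) with v : ℕ.  An edge picks
-- exactly one vertex in every class, i.e. it is a vector e with e[i] ∈ V_i.
Edge : ℕ → Set
Edge r = Vec ℕ r

Graph : ℕ → Set
Graph r = List (Edge r)

Vertex : ℕ → Set
Vertex r = Σ (Fin r) (λ _ → ℕ)

_∈ᵥ_ : ∀ {r} → Vertex r → Edge r → Set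
(i Data.Product., v) ∈ᵥ e = lookup e i ≡ v

Intersect : ∀ {r} → Edge r → Edge r → Set
Intersect {r} e f = ∃ λ (i : Fin r) → lookup e i ≡ lookup f i

IntersectsAll : ∀ {r n} → Edge r → Vec (Edge r) n → Set
IntersectsAll {n = n} f es = (j : Fin n) → Intersect f (lookup es j)

AllIn : ∀ {r n} → Vec (Edge r) n → Graph r → Set
AllIn {n = n} es H = (j : Fin n) → lookup es j ∈ H

IsCover : ∀ {r} → List (Vertex r) → Graph r → Set
IsCover C H = ∀ {e} → e ∈ H → ∃ λ x → x ∈ C × x ∈ᵥ e

CoverNumber≤ : ∀ {r} → Graph r → ℕ → Set
CoverNumber≤ {r} H n = ∃ λ (C : List (Vertex r)) → length C ≤ n × IsCover C H

-- (k,m)-coverability of H₀, witnessed by a chain Hs 0 = H₀ ⊇ Hs 1 ⊇ … ⊇ Hs m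
-- (values of Hs beyond m are irrelevant).
record Chain (r k m : ℕ) (H₀ : Graph r) (Hs : ℕ → Graph r) : Set where
  field
    base   : Hs 0 ≡ H₀
    nested : ∀ i → i < m → Hs (suc i) ⊆ Hs i
    P1 : (es : Vec (Edge r) (k ∸ 1)) → AllIn es H₀ →
         ∃ λ e → e ∈ Hs m × IntersectsAll e es
    P2 : (es : Vec (Edge r) (k ∸ 1)) → AllIn es H₀ →
         ∀ i → i < m → ∀ {eₖ} → eₖ ∈ Hs i →
         ∃ λ f → f ∈ Hs (suc i) × IntersectsAll f es × Intersect f eₖ
    P3 : ∀ {e f} → e ∈ Hs m → f ∈ Hs m → Intersect e f

Coverable : (r k m : ℕ) → Graph r → Set
Coverable r k m H₀ = ∃ λ (Hs : ℕ → Graph r) → Chain r k m H₀ Hs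

-- Fix an edge g of H_m (P1 provides one unless H₀ is empty).  Unless
-- τ(H₀) ≤ r², every H_i contains an edge disjoint from g, which for i = m
-- contradicts (P3).  Induction on i: given t ∈ H_i missing g, pick greedily
-- r - 1 pairwise disjoint edges of H₀ avoiding the vertices of g and t; if
-- the greedy search gets stuck, the 2r + r(r - 2) = r² vertices collected so
-- far cover H₀.  By (P2) some f ∈ H_{i+1} meets t and these r - 1 edges; f
-- thus meets r pairwise disjoint edges that all miss g, and by pigeonhole on
-- the r coordinates it cannot meet g as well.
module Submission where

open import Defs
open import Data.Nat using (ℕ; _≤_; _*_; zero; suc; _+_; _<_; z≤n; s≤s)
open import Data.Nat.Properties
  using (≤-refl; ≤-trans; ≤-reflexive; m≤m+n; m≤m*n; n<1+n; *-suc; +-assoc; +-comm; <⇒≤)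
import Data.Nat.Properties as ℕ
open import Data.Fin using (Fin; zero; suc; punchOut) renaming (_<_ to _<ᶠ_)
open import Data.Fin.Properties using (pigeonhole; punchOut-injective; <⇒≢)
open import Data.Vec using (Vec; lookup; replicate; _∷_; [])
open import Data.Vec.Properties using (lookup-replicate)
open import Data.List using (List; length; tabulate; _++_; []; _∷_)
open import Data.List.Properties using (length-tabulate; length-++)
open import Data.List.Membership.Propositional using (_∈_)
open import Data.List.Membership.Propositional.Properties using (∈-tabulate⁺; ∈-++⁺ˡ; ∈-++⁺ʳ)
open import Data.List.Relation.Unary.Any using (here; there)
open import Data.Product using (∃; ∃₂; _×_; _,_; proj₁; proj₂)
open import Data.Sum using (_⊎_; inj₁; inj₂)
open import Data.Empty using (⊥; ⊥-elim)
open import Function using (_∘_)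
open import Relation.Nullary using (¬_; yes; no)
open import Relation.Binary.PropositionalEquality
  using (_≡_; _≢_; refl; sym; trans; cong; cong₂; subst; module ≡-Reasoning)

vertices : ∀ {r} → Edge r → List (Vertex r)
vertices e = tabulate (λ i → (i , lookup e i))

length-vertices : ∀ {r} (e : Edge r) → length (vertices e) ≡ r
length-vertices e = length-tabulate (λ i → (i , lookup e i))

Avoids : ∀ {r} → List (Vertex r) → Edge r → Set
Avoids X e = ∀ {x} → x ∈ X → ¬ (x ∈ᵥ e)

avoids-vertices⇒¬Intersect : ∀ {r} {e f : Edge r} → Avoids (vertices f) e → ¬ Intersect e f
avoids-vertices⇒¬Intersect {f = f} av (i , eᵢ≡fᵢ) =
  av (∈-tabulate⁺ {f = λ i → (i , lookup f i)} i) eᵢ≡fᵢ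

avoids-++ˡ : ∀ {r} {X Y : List (Vertex r)} {e} → Avoids (X ++ Y) e → Avoids X e
avoids-++ˡ av x∈X = av (∈-++⁺ˡ x∈X)

avoids-++ʳ : ∀ {r} (X : List (Vertex r)) {Y e} → Avoids (X ++ Y) e → Avoids Y e
avoids-++ʳ X av x∈Y = av (∈-++⁺ʳ X x∈Y)

meets-or-avoids : ∀ {r} (X : List (Vertex r)) (e : Edge r) →
                  (∃ λ x → x ∈ X × x ∈ᵥ e) ⊎ Avoids X e
meets-or-avoids [] e = inj₂ (λ ())
meets-or-avoids ((i , v) ∷ X) e with lookup e i ℕ.≟ v | meets-or-avoids X e
... | yes eᵢ≡v | _                    = inj₁ ((i , v) , here refl , eᵢ≡v)
... | no _     | inj₁ (x , x∈X , x∈e) = inj₁ (x , there x∈X , x∈e)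
... | no eᵢ≢v  | inj₂ av              = inj₂ λ { (here refl) → eᵢ≢v ; (there x∈X) → av x∈X }

cover-or-avoider : ∀ {r} (X : List (Vertex r)) (H : Graph r) →
                   IsCover X H ⊎ (∃ λ e → e ∈ H × Avoids X e)
cover-or-avoider X [] = inj₁ (λ ())
cover-or-avoider X (e ∷ H) with meets-or-avoids X e | cover-or-avoider X H
... | inj₂ av  | _                      = inj₂ (e , here refl , av)
... | inj₁ _   | inj₂ (f , f∈H , av)    = inj₂ (f , there f∈H , av)
... | inj₁ hit | inj₁ cov               = inj₁ λ { (here refl) → hit ; (there e∈H) → cov e∈H }

intersect-sym : ∀ {r} {e f : Edge r} → Intersect e f → Intersect f e
intersect-sym (i , eᵢ≡fᵢ) = i , sym eᵢ≡fᵢ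

PairwiseDisjoint : ∀ {r k} → Vec (Edge r) k → Set
PairwiseDisjoint {k = k} es =
  ∀ (j j′ : Fin k) → j ≢ j′ → ¬ Intersect (lookup es j) (lookup es j′)

pairwiseDisjoint-∷ : ∀ {r k e} {es : Vec (Edge r) k} →
                     (∀ j → ¬ Intersect (lookup es j) e) →
                     PairwiseDisjoint es → PairwiseDisjoint (e ∷ es)
pairwiseDisjoint-∷ esₑ dj zero zero 0≢0 = ⊥-elim (0≢0 refl)
pairwiseDisjoint-∷ {e = e} {es} esₑ dj zero (suc j) _ =
  esₑ j ∘ intersect-sym {e = e} {f = lookup es j}
pairwiseDisjoint-∷ esₑ dj (suc j) zero _ = esₑ j
pairwiseDisjoint-∷ esₑ dj (suc j) (suc j′) j≢j′ = dj j j′ (j≢j′ ∘ cong suc)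

module _ {r} (H : Graph r) where

  AvoidingMatching : ∀ {k} → List (Vertex r) → Vec (Edge r) k → Set
  AvoidingMatching X es = AllIn es H × (∀ j → Avoids X (lookup es j)) × PairwiseDisjoint es

  matching-∷ : ∀ {k e X} → e ∈ H → Avoids X e →
               ∃ (AvoidingMatching {k = k} (vertices e ++ X)) →
               ∃ (AvoidingMatching {k = suc k} X)
  matching-∷ {e = e} {X} e∈H av (es , es∈H , avs , dj) =
    e ∷ es , (λ { zero → e∈H ; (suc j) → es∈H j }) ,
    (λ { zero → av ; (suc j) → avoids-++ʳ (vertices e) {e = lookup es j} (avs j) }) ,
    pairwiseDisjoint-∷ (λ j → avoids-vertices⇒¬Intersect {e = lookup es j} {f = e}
                               (avoids-++ˡ {Y = X} {e = lookup es j} (avs j))) dj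

  cover-or-matching : ∀ k (X : List (Vertex r)) →
                      CoverNumber≤ H (length X + r * k) ⊎ ∃ (AvoidingMatching {k = suc k} X)
  cover-or-matching k X with cover-or-avoider X H
  ... | inj₁ cov            = inj₁ (X , m≤m+n _ _ , cov)
  ... | inj₂ (e , e∈H , av) with k
  ...   | zero  = inj₂ (matching-∷ e∈H av ([] , (λ ()) , (λ ()) , (λ ())))
  ...   | suc k with cover-or-matching k (vertices e ++ X)
  ...     | inj₂ matching = inj₂ (matching-∷ e∈H av matching)
  ...     | inj₁ cov      = inj₁ (subst (CoverNumber≤ H) bound cov)
    where
      open ≡-Reasoning
      bound : length (vertices e ++ X) + r * k ≡ length X + r * suc k
      bound = begin
        length (vertices e ++ X) + r * k  ≡⟨ cong (_+ r * k) (length-++ (vertices e)) ⟩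
        length (vertices e) + length X + r * k
          ≡⟨ cong (λ l → l + length X + r * k) (length-vertices e) ⟩
        r + length X + r * k              ≡⟨ cong (_+ r * k) (+-comm r (length X)) ⟩
        length X + r + r * k              ≡⟨ +-assoc (length X) r (r * k) ⟩
        length X + (r + r * k)            ≡⟨ cong (length X +_) (sym (*-suc r k)) ⟩
        length X + r * suc k              ∎

-- If f met g at coordinate c, f would have to meet each of the r edges es
-- at one of the other r - 1 coordinates, so two of them would share a vertex.
transversal-misses : ∀ {n} (es : Vec (Edge (suc n)) (suc n)) → PairwiseDisjoint es →
                     ∀ {f g} → IntersectsAll f es →
                     (∀ j → ¬ Intersect (lookup es j) g) → ¬ Intersect f g
transversal-misses {n} es dj {f} {g} f-es es-g (c , f꜀≡g꜀) =
  collision⇒⊥ (pigeonhole (n<1+n n) (λ j → punchOut (c≢meet j)))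
  where
    meet : Fin (suc n) → Fin (suc n)
    meet j = proj₁ (f-es j)

    f≡es-at-meet : ∀ j → lookup f (meet j) ≡ lookup (lookup es j) (meet j)
    f≡es-at-meet j = proj₂ (f-es j)

    c≢meet : ∀ j → c ≢ meet j
    c≢meet j refl = es-g j (c , trans (sym (f≡es-at-meet j)) f꜀≡g꜀)

    collision⇒⊥ : ∃₂ (λ i j → i <ᶠ j × punchOut (c≢meet i) ≡ punchOut (c≢meet j)) → ⊥
    collision⇒⊥ (i , j , i<j , pᵢ≡pⱼ) = dj i j (<⇒≢ i<j) (meet i , esᵢ≡esⱼ)
      where
        meetᵢ≡meetⱼ : meet i ≡ meet j
        meetᵢ≡meetⱼ = punchOut-injective (c≢meet i) (c≢meet j) pᵢ≡pⱼ

        esᵢ≡esⱼ : lookup (lookup es i) (meet i) ≡ lookup (lookup es j) (meet i)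
        esᵢ≡esⱼ = trans (sym (f≡es-at-meet i))
                    (subst (λ d → lookup f d ≡ lookup (lookup es j) d)
                           (sym meetᵢ≡meetⱼ) (f≡es-at-meet j))

module _ {n m} {H₀ : Graph (2 + n)} {Hs : ℕ → Graph (2 + n)}
         (chain : Chain (2 + n) (2 + n) m H₀ Hs) (g : Edge (2 + n)) where

  open Chain chain

  private
    r = 2 + n

  DisjointEdgeIn : Graph r → Set
  DisjointEdgeIn H = ∃ λ t → t ∈ H × ¬ Intersect t g

  cover-or-disjoint-edge-step : ∀ {i} → i < m → DisjointEdgeIn (Hs i) →
                                CoverNumber≤ H₀ (r * r) ⊎ DisjointEdgeIn (Hs (suc i))
  cover-or-disjoint-edge-step {i} i<m (t , t∈Hᵢ , t∦g) with cover-or-matching H₀ n (vertices g ++ vertices t)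
  ... | inj₁ cov = inj₁ (subst (CoverNumber≤ H₀) bound cov)
    where
      open ≡-Reasoning
      bound : length (vertices g ++ vertices t) + r * n ≡ r * r
      bound = begin
        length (vertices g ++ vertices t) + r * n
          ≡⟨ cong (_+ r * n) (length-++ (vertices g)) ⟩
        length (vertices g) + length (vertices t) + r * n
          ≡⟨ cong₂ (λ a b → a + b + r * n) (length-vertices g) (length-vertices t) ⟩
        r + r + r * n    ≡⟨ +-assoc r r (r * n) ⟩
        r + (r + r * n)  ≡⟨ cong (r +_) (sym (*-suc r n)) ⟩
        r + r * suc n    ≡⟨ sym (*-suc r (suc n)) ⟩
        r * r            ∎
  ... | inj₂ (es , es∈H₀ , avs , dj) with P2 es es∈H₀ i i<m t∈Hᵢ
  ...   | f , f∈Hᵢ₊₁ , f-es , f-t = inj₂ (f , f∈Hᵢ₊₁ ,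
          transversal-misses (t ∷ es) (pairwiseDisjoint-∷ {e = t} es-t dj) {f} {g}
                             f-t∷es t∷es-g)
    where
      es-t : ∀ j → ¬ Intersect (lookup es j) t
      es-t j = avoids-vertices⇒¬Intersect {e = lookup es j} {f = t}
                 (avoids-++ʳ (vertices g) {e = lookup es j} (avs j))

      f-t∷es : IntersectsAll f (t ∷ es)
      f-t∷es zero    = f-t
      f-t∷es (suc j) = f-es j

      t∷es-g : ∀ j → ¬ Intersect (lookup (t ∷ es) j) g
      t∷es-g zero    = t∦g
      t∷es-g (suc j) = avoids-vertices⇒¬Intersect {e = lookup es j} {f = g}
                         (avoids-++ˡ {Y = vertices t} {e = lookup es j} (avs j))

  cover-or-disjoint-edge : ∀ i → i ≤ m → CoverNumber≤ H₀ (r * r) ⊎ DisjointEdgeIn (Hs i)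
  cover-or-disjoint-edge zero _ with cover-or-avoider (vertices g) H₀
  ... | inj₁ cov =
    inj₁ (vertices g , ≤-trans (≤-reflexive (length-vertices g)) (m≤m*n r r) , cov)
  ... | inj₂ (t , t∈H₀ , av) =
    inj₂ (t , subst (t ∈_) (sym base) t∈H₀ , avoids-vertices⇒¬Intersect {e = t} {f = g} av)
  cover-or-disjoint-edge (suc i) i<m with cover-or-disjoint-edge i (<⇒≤ i<m)
  ... | inj₁ cov      = inj₁ cov
  ... | inj₂ disjoint = cover-or-disjoint-edge-step i<m disjoint

lemma3p5 : (r : ℕ) → 2 ≤ r → (m : ℕ) → 1 ≤ m → (H₀ : Graph r) →
    Coverable r r m H₀ → CoverNumber≤ H₀ (r * r)
lemma3p5 (suc (suc n)) (s≤s (s≤s z≤n)) m _ [] _ = [] , z≤n , λ ()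
lemma3p5 (suc (suc n)) (s≤s (s≤s z≤n)) m _ H₀@(e ∷ _) (Hs , chain)
  with Chain.P1 chain (replicate _ e) (λ j → subst (_∈ H₀) (sym (lookup-replicate j e)) (here refl))
... | g , g∈Hₘ , _ with cover-or-disjoint-edge chain g m ≤-refl
...   | inj₁ cov             = cov
...   | inj₂ (t , t∈Hₘ , t∦g) = ⊥-elim (t∦g (Chain.P3 chain t∈Hₘ g∈Hₘ))
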